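{- For all integers $q,n\ge 2$, $N_3(q,n)>2^{f(q,n-1)-1}$.
   Context: $N_3(q,n)$ is the smallest $N$ such that every coloring of the 3-element subsets of $[N]$ with $q$ colors admits integers $j_1<\dots<j_n$ in $[N]$ such that all triples $\{j_i,j_{i+1},j_{i+2}\}$, $1\le i\le n-2$, have the same color. $f(q,m)$ is the smallest $N$ such that every $q$-coloring of the edges of the complete digraph on $N$ vertices (two oppositely directed edges between any two distinct vertices, no loops) contains a monochromatic walk of length $m$, i.e., a sequence of $m$ vertices $v_1,\dots,v_m$ (repetitions allowed) such that all edges $\overrightarrow{v_iv_{i+1}}$ have the same color. -}

module Defs where

open import Data.Nat using (ℕ; zero; suc; _+_; _≤_; _<_)
open import Data.Fin as Fin using (Fin)
open import Data.Product using (_×_; Σ-syntax)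
open import Relation.Binary.PropositionalEquality using (_≡_; _≢_)

IsLeast : (ℕ → Set) → ℕ → Set
IsLeast P N = P N × (∀ M → P M → N ≤ M)

-- A q-colouring of the 3-element subsets of [N] = Fin N: the colour of
-- {i < j < k} is c i j k (values on non-increasing triples are irrelevant).
TripleColouring : ℕ → ℕ → Set
TripleColouring q N = Fin N → Fin N → Fin N → Fin q

HasMonoTightPath : ∀ {q N} → TripleColouring q N → ℕ → Set
HasMonoTightPath {q} {N} c n =
  Σ[ j ∈ (ℕ → Fin N) ] Σ[ a ∈ Fin q ]
    ((∀ i → suc i < n → j i Fin.< j (suc i)) ×
     (∀ i → suc (suc i) < n → c (j i) (j (suc i)) (j (suc (suc i))) ≡ a))

N3Prop : ℕ → ℕ → ℕ → Set
N3Prop q n N = (c : TripleColouring q N) → HasMonoTightPath c n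

-- A q-colouring of the edges of the complete digraph on Fin N:
-- the directed edge u → v (u ≢ v) gets colour c u v (loops irrelevant).
ArcColouring : ℕ → ℕ → Set
ArcColouring q N = Fin N → Fin N → Fin q

-- Monochromatic walk with m vertices v_0 … v_{m-1} (repetitions allowed,
-- consecutive vertices distinct since there are no loops).
HasMonoWalk : ∀ {q N} → ArcColouring q N → ℕ → Set
HasMonoWalk {q} {N} c m =
  Σ[ v ∈ (ℕ → Fin N) ] Σ[ a ∈ Fin q ]
    ((∀ i → suc i < m → v i ≢ v (suc i)) ×
     (∀ i → suc i < m → c (v i) (v (suc i)) ≡ a))

FProp : ℕ → ℕ → ℕ → Set
FProp q m N = (c : ArcColouring q N) → HasMonoWalk c m

module Submission where

-- For a < b in [2^k] let δ k a b be the position of the highest binary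
-- digit in which a and b differ.  The key fact (δ-consecutive-distinct) is
-- that for a < b < c the two "differences" δ a b and δ b c are distinct:
-- they are arcs of the complete digraph on [k] joining consecutively.
-- Given an arc colouring χ of [K], colour the triple a < b < c of [2^K] by
-- χ (δ a b) (δ b c).  A monochromatic tight path j_0 < … < j_{n-1} then
-- yields the monochromatic walk δ j_0 j_1, …, δ j_{n-2} j_{n-1} with n-1
-- vertices.  Hence N_3(q,n) ≤ 2^K forces f(q,n-1) ≤ K (stepping-up), and
-- applying this with K = f(q,n-1) - 1 contradicts the minimality of f.

open import Defs
open import Data.Nat using (ℕ; zero; suc; pred; _≤_; _<_; _^_; _∸_; _+_; z≤n; s≤s; _<?_)
open import Data.Nat.Properties
open import Data.Fin as Fin using (Fin; toℕ; fromℕ<)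
open import Data.Fin.Properties using (toℕ<n; fromℕ<-injective; ¬Fin0)
open import Data.Product using (_,_; proj₁; proj₂)
open import Data.Empty using (⊥-elim)
open import Relation.Nullary using (¬_; yes; no)
open import Relation.Binary.PropositionalEquality using (_≡_; _≢_; refl; sym; trans)

-- δ k a b: index of the highest of the k low binary digits in which a and
-- b differ (0 if there is none), computed by halving the range [2^k].
δ : ℕ → ℕ → ℕ → ℕ
δ zero    a b = 0
δ (suc k) a b with a <? 2 ^ k | b <? 2 ^ k
... | yes _ | yes _ = δ k a b
... | no _  | no _  = δ k (a ∸ 2 ^ k) (b ∸ 2 ^ k)
... | _     | _     = k

δ-≤-pred : ∀ k a b → δ k a b ≤ pred k
δ-≤-pred zero    a b = z≤n
δ-≤-pred (suc k) a b with a <? 2 ^ k | b <? 2 ^ k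
... | yes _ | yes _ = ≤-trans (δ-≤-pred k a b) pred[n]≤n
... | no _  | no _  = ≤-trans (δ-≤-pred k _ _) pred[n]≤n
... | yes _ | no _  = ≤-refl
... | no _  | yes _ = ≤-refl

δ-< : ∀ k {a b} → a < b → b < 2 ^ k → δ k a b < k
δ-< zero    {b = zero}  () _
δ-< zero    {b = suc _} _  (s≤s ())
δ-< (suc k) {a} {b} _ _ = s≤s (δ-≤-pred (suc k) a b)

upper-half : ∀ k {c} → 2 ^ k ≤ c → c < 2 ^ suc k → c ∸ 2 ^ k < 2 ^ k
upper-half k {c} 2^k≤c c<2^k+1 = <-≤-trans (∸-monoˡ-< c<2^k+1 2^k≤c) 2^k+1∸2^k≤2^k
  where
  2^k+1∸2^k≤2^k : 2 ^ suc k ∸ 2 ^ k ≤ 2 ^ k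
  2^k+1∸2^k≤2^k = ≤-reflexive (trans (m+n∸m≡n (2 ^ k) (2 ^ k + 0)) (+-identityʳ (2 ^ k)))

-- If a, b, c lie
-- in the same half we recurse; otherwise one of the two equals k - 1 (the
-- top digit) while the other, computed inside one half, is smaller.
δ-consecutive-distinct : ∀ k {a b c} → a < b → b < c → c < 2 ^ k → δ k a b ≢ δ k b c
δ-consecutive-distinct zero {c = zero}  _ () _
δ-consecutive-distinct zero {c = suc _} _ _  (s≤s ())
δ-consecutive-distinct (suc k) {a} {b} {c} a<b b<c c<2^k+1
  with a <? 2 ^ k | b <? 2 ^ k | c <? 2 ^ k
... | yes _  | yes _  | yes c<2^k = δ-consecutive-distinct k a<b b<c c<2^k
... | yes _  | yes b<2^k | no _   = <⇒≢ (δ-< k a<b b<2^k)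
... | yes _  | no b≮2^k | no c≮2^k =
  λ eq → <⇒≢ (δ-< k (∸-monoˡ-< b<c (≮⇒≥ b≮2^k)) (upper-half k (≮⇒≥ c≮2^k) c<2^k+1)) (sym eq)
... | no a≮2^k | no b≮2^k | no c≮2^k =
  δ-consecutive-distinct k (∸-monoˡ-< a<b (≮⇒≥ a≮2^k)) (∸-monoˡ-< b<c (≮⇒≥ b≮2^k))
    (upper-half k (≮⇒≥ c≮2^k) c<2^k+1)
... | _      | no b≮2^k | yes c<2^k = ⊥-elim (b≮2^k (<-trans b<c c<2^k))
... | no a≮2^k | yes b<2^k | _      = ⊥-elim (a≮2^k (<-trans a<b b<2^k))

δ-vertex : ∀ K → ℕ → ℕ → Fin (suc K)
δ-vertex K a b = fromℕ< (s≤s (δ-≤-pred (suc K) a b))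

tight-path-order : ∀ {q N n} {c : TripleColouring q N} → 2 ≤ n → HasMonoTightPath c n → 2 ≤ N
tight-path-order 2≤n (j , _ , increasing , _) =
  ≤-<-trans (≤-trans (s≤s z≤n) (increasing 0 2≤n)) (toℕ<n (j 1))

stepping-up : ∀ {q n M} K → 1 ≤ q → 2 ≤ n → M ≤ 2 ^ K → N3Prop q n M → FProp q (n ∸ 1) K
stepping-up zero (s≤s z≤n) 2≤n M≤1 hasPath _ =
  ⊥-elim (<-irrefl refl (≤-trans (tight-path-order 2≤n (hasPath (λ _ _ _ → Fin.zero))) M≤1))
stepping-up {q} {suc m} {M} (suc K) _ _ M≤2^K hasPath χ = v , a , distinct , monochromatic
  where
  colour : TripleColouring q M
  colour x y z = χ (δ-vertex K (toℕ x) (toℕ y)) (δ-vertex K (toℕ y) (toℕ z))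
  path = hasPath colour
  j = proj₁ path
  a = proj₁ (proj₂ path)
  increasing = proj₁ (proj₂ (proj₂ path))
  samecolour = proj₂ (proj₂ (proj₂ path))

  v : ℕ → Fin (suc K)
  v i = δ-vertex K (toℕ (j i)) (toℕ (j (suc i)))

  distinct : ∀ i → suc i < m → v i ≢ v (suc i)
  distinct i si<m eq = δ-consecutive-distinct (suc K)
    (increasing i (<-trans (n<1+n (suc i)) (s≤s si<m)))
    (increasing (suc i) (s≤s si<m))
    (<-≤-trans (toℕ<n (j (suc (suc i)))) M≤2^K)
    (fromℕ<-injective _ _ _ _ eq)

  monochromatic : ∀ i → suc i < m → χ (v i) (v (suc i)) ≡ a
  monochromatic i si<m = samecolour i (s≤s si<m)

no-walk-on-empty : ∀ q m → ¬ FProp q m 0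
no-walk-on-empty q m hasWalk = ¬Fin0 (proj₁ (hasWalk (λ ())) 0)

theorem10 : (q n : ℕ) → 2 ≤ q → 2 ≤ n →
    (F M : ℕ) → IsLeast (FProp q (n ∸ 1)) F → IsLeast (N3Prop q n) M →
    2 ^ (F ∸ 1) < M
theorem10 q n _ _ zero M (hasWalk , _) _ = ⊥-elim (no-walk-on-empty q (n ∸ 1) hasWalk)
theorem10 q n 2≤q 2≤n (suc K) M (_ , fLeast) (hasPath , _) =
  ≰⇒> λ M≤2^K → n≮n K (fLeast K (stepping-up K (≤-trans (s≤s z≤n) 2≤q) 2≤n M≤2^K hasPath))
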